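{- Let $i$ be an inert term and let $\pi\triangleright\Gamma\vdash i:M$ be an inert type derivation. Then $|i|=|\pi|$, and $|\pi|\leq|\sigma|$ for every type derivation $\sigma$ whose conclusion types $i$ (i.e. $\sigma\triangleright\Delta\vdash i:N$ for some $\Delta$, $N$).
   Context: Terms: $t,u ::= x \mid \lambda x.t \mid tu$, up to $\alpha$-equivalence. Values: $v ::= x \mid \lambda x.t$. Fireballs $f$ and inert terms $i$ are defined by mutual induction: $f ::= v \mid i$ and $i ::= x f_1 \dots f_n$ with $n>0$ (application left-associative). Size of terms: $|v|=0$ for values, $|tu|=|t|+|u|+1$. Multi types: linear types $L ::= M\multimap N$; multi types $M,N ::= [L_1,\dots,L_n]$ (finite multisets, $n\ge 0$); $\mathbf 0$ empty multiset, $\uplus$ multiset sum. Type context $\Gamma$: total map from variables to multi types with finite $\mathrm{dom}(\Gamma)=\{x\mid \Gamma(x)\ne\mathbf 0\}$; $(\Gamma\uplus\Delta)(x)=\Gamma(x)\uplus\Delta(x)$; $x:M$ maps $x$ to $M$ and all else to $\mathbf 0$; $\Gamma,x:M$ extends $\Gamma$ ($x\notin\mathrm{dom}(\Gamma)$) by $x\mapsto M$. Typing rules: (ax) $x:M\vdash x:M$; (@) from $\Gamma\vdash t:[M\multimap N]$ and $\Delta\vdash u:M$ infer $\Gamma\uplus\Delta\vdash tu:N$; ($\lambda$) from $\Gamma_k,x:M_k\vdash t:N_k$ for $k=1,\dots,n$ ($n\ge0$) infer $\Gamma_1\uplus\dots\uplus\Gamma_n\vdash\lambda x.t:[M_1\multimap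 N_1,\dots,M_n\multimap N_n]$. $|\pi|$ is the number of (@) rules in $\pi$. Inert multi types are defined inductively as finite multisets (possibly empty) of linear types $\mathbf 0\multimap N$ with $N$ an inert multi type; a type context is inert if all its values are inert multi types. A derivation $\pi\triangleright\Gamma\vdash e:M$ is inert if $\Gamma$ and $M$ are inert. -}

module Defs where

open import Data.Nat using (ℕ; zero; suc; _+_; _≡ᵇ_)
open import Data.Bool using (if_then_else_)
open import Data.List using (List; []; _∷_; _++_)

-- Terms (raw, with named variables; all notions below are α-invariant)

Var : Set
Var = ℕ

data Term : Set where
  var : Var → Term
  ƛ   : Var → Term → Term
  _·_ : Term → Term → Term

infixl 7 _·_

data Value : Term → Set where
  v-var : ∀ {x} → Value (var x)
  v-lam : ∀ {x t} → Value (ƛ x t)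

mutual
  data Fireball : Term → Set where
    f-val   : ∀ {t} → Value t → Fireball t
    f-inert : ∀ {t} → Inert t → Fireball t

  data Inert : Term → Set where
    i-var : ∀ {x f} → Fireball f → Inert (var x · f)
    i-app : ∀ {i f} → Inert i → Fireball f → Inert (i · f)

size : Term → ℕ
size (var x) = 0
size (ƛ x t) = 0
size (t · u) = size t + size u + 1

-- Multi types: linear types L ::= M ⊸ N, multi types = finite multisets
-- of linear types, represented by lists up to permutation (_≈M_).

data LTy : Set where
  _⊸_ : List LTy → List LTy → LTy

MTy : Set
MTy = List LTy

𝟎 : MTy
𝟎 = []

mutual
  data _≈L_ : LTy → LTy → Set where
    ⊸-cong : ∀ {M M' N N'} → M ≈M M' → N ≈M N' → (M ⊸ N) ≈L (M' ⊸ N')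

  data _≈M_ : MTy → MTy → Set where
    []    : [] ≈M []
    _∷_   : ∀ {L L' Ls Ls'} → L ≈L L' → Ls ≈M Ls' → (L ∷ Ls) ≈M (L' ∷ Ls')
    swap  : ∀ {L L' Ls} → (L ∷ L' ∷ Ls) ≈M (L' ∷ L ∷ Ls)
    trans : ∀ {Ls Ls' Ls''} → Ls ≈M Ls' → Ls' ≈M Ls'' → Ls ≈M Ls''

Ctx : Set
Ctx = Var → MTy

∅ : Ctx
∅ _ = 𝟎

_⊎_ : Ctx → Ctx → Ctx
(Γ ⊎ Δ) y = Γ y ++ Δ y

_∶_ : Var → MTy → Ctx
(x ∶ M) y = if y ≡ᵇ x then M else 𝟎

_∖_ : Ctx → Var → Ctx
(Γ ∖ x) y = if y ≡ᵇ x then 𝟎 else Γ y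

_≈C_ : Ctx → Ctx → Set
Γ ≈C Δ = ∀ y → Γ y ≈M Δ y

infix 4 _⊢_⦂_

mutual
  data _⊢_⦂_ : Ctx → Term → MTy → Set where
    ax  : ∀ {Γ x M} → Γ ≈C (x ∶ M) → Γ ⊢ var x ⦂ M
    app : ∀ {Θ Γ Δ t u M M' N} →
          Γ ⊢ t ⦂ ((M ⊸ N) ∷ []) → Δ ⊢ u ⦂ M' → M ≈M M' →
          Θ ≈C (Γ ⊎ Δ) → Θ ⊢ t · u ⦂ N
    lam : ∀ {Θ Γ x t Ls} → LamPrems x t Γ Ls → Θ ≈C Γ → Θ ⊢ ƛ x t ⦂ Ls

  -- The n ≥ 0 premises Γₖ , x : Mₖ ⊢ t : Nₖ of the λ rule; premise k has
  -- context Θₖ, so Γₖ = Θₖ ∖ x and Mₖ = Θₖ x.  Indexed by Γ₁ ⊎ … ⊎ Γₙ and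
  -- [M₁ ⊸ N₁ , … , Mₙ ⊸ Nₙ].
  data LamPrems (x : Var) (t : Term) : Ctx → MTy → Set where
    []  : LamPrems x t ∅ []
    _∷_ : ∀ {Θ N Γ Ls} → Θ ⊢ t ⦂ N → LamPrems x t Γ Ls →
          LamPrems x t ((Θ ∖ x) ⊎ Γ) ((Θ x ⊸ N) ∷ Ls)

mutual
  ∣_∣ : ∀ {Γ t M} → Γ ⊢ t ⦂ M → ℕ
  ∣ ax _ ∣ = 0
  ∣ app π σ _ _ ∣ = ∣ π ∣ + ∣ σ ∣ + 1
  ∣ lam ps _ ∣ = ∣ ps ∣*

  ∣_∣* : ∀ {x t Γ Ls} → LamPrems x t Γ Ls → ℕ
  ∣ [] ∣* = 0
  ∣ π ∷ ps ∣* = ∣ π ∣ + ∣ ps ∣*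

data InertM : MTy → Set where
  []  : InertM []
  _∷_ : ∀ {N Ls} → InertM N → InertM Ls → InertM ((𝟎 ⊸ N) ∷ Ls)

InertCtx : Ctx → Set
InertCtx Γ = ∀ x → InertM (Γ x)

-- An inert term x f₁ … fₙ is typed by applying an operator whose type, by
-- induction, is drawn from the inert context, hence is an inert arrow
-- [𝟎 ⊸ N]. So every argument fᵢ receives the empty multi type 𝟎, and a
-- fireball typed by 𝟎 is either a variable, a λ with no premises, or again
-- inert. Such a derivation has exactly one (@) per application in i, while
-- any derivation of a term has at least one (@) per application.
module Submission where

open import Defs
open import Data.Nat using (_≤_; z≤n; _+_)
open import Data.Nat.Properties using (≤-refl; +-mono-≤; ≡⇒≡ᵇ)
open import Data.Bool.Properties using (T-≡)
open import Data.List using ([]; _∷_; _++_)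
open import Data.Product using (_×_; _,_)
open import Function.Bundles using (Equivalence)
open import Relation.Binary.PropositionalEquality using (_≡_; refl; cong; cong₂; subst)

[]≈M⇒≡[] : ∀ {M} → [] ≈M M → M ≡ []
[]≈M⇒≡[] [] = refl
[]≈M⇒≡[] (trans p q) with []≈M⇒≡[] p
... | refl = []≈M⇒≡[] q

InertM-resp-≈M : ∀ {M N} → InertM M → M ≈M N → InertM N
InertM-resp-≈M [] [] = []
InertM-resp-≈M (n ∷ ns) (⊸-cong 𝟎≈M N≈N′ ∷ p) with []≈M⇒≡[] 𝟎≈M
... | refl = InertM-resp-≈M n N≈N′ ∷ InertM-resp-≈M ns p
InertM-resp-≈M (m ∷ n ∷ ns) swap = n ∷ m ∷ ns
InertM-resp-≈M i (trans p q) = InertM-resp-≈M (InertM-resp-≈M i p) q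

InertM-++⁻ˡ : ∀ M {N} → InertM (M ++ N) → InertM M
InertM-++⁻ˡ []      _        = []
InertM-++⁻ˡ (_ ∷ M) (n ∷ ns) = n ∷ InertM-++⁻ˡ M ns

InertM-++⁻ʳ : ∀ M {N} → InertM (M ++ N) → InertM N
InertM-++⁻ʳ []      i        = i
InertM-++⁻ʳ (_ ∷ M) (_ ∷ ns) = InertM-++⁻ʳ M ns

InertCtx-⊎⁻ˡ : ∀ {Θ Γ Δ} → InertCtx Θ → Θ ≈C (Γ ⊎ Δ) → InertCtx Γ
InertCtx-⊎⁻ˡ {Γ = Γ} iΘ e y = InertM-++⁻ˡ (Γ y) (InertM-resp-≈M (iΘ y) (e y))

InertCtx-⊎⁻ʳ : ∀ {Θ Γ Δ} → InertCtx Θ → Θ ≈C (Γ ⊎ Δ) → InertCtx Δ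
InertCtx-⊎⁻ʳ {Γ = Γ} iΘ e y = InertM-++⁻ʳ (Γ y) (InertM-resp-≈M (iΘ y) (e y))

∶-lookup : ∀ x M → (x ∶ M) x ≡ M
∶-lookup x M rewrite Equivalence.to T-≡ (≡⇒≡ᵇ x x refl) = refl

InertCtx-∶⁻ : ∀ {Γ x M} → InertCtx Γ → Γ ≈C (x ∶ M) → InertM M
InertCtx-∶⁻ {x = x} {M} iΓ e =
  subst InertM (∶-lookup x M) (InertM-resp-≈M (iΓ x) (e x))

InertM-⊸-source : ∀ {M M′ N} → InertM ((M ⊸ N) ∷ []) → M ≈M M′ → M′ ≡ 𝟎
InertM-⊸-source (_ ∷ []) = []≈M⇒≡[]

InertM-⊸-target : ∀ {M N} → InertM ((M ⊸ N) ∷ []) → InertM N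
InertM-⊸-target (n ∷ []) = n

mutual
  operator-InertM : ∀ {t u Γ L} → Inert (t · u) → Γ ⊢ t ⦂ (L ∷ []) →
                    InertCtx Γ → InertM (L ∷ [])
  operator-InertM (i-var _)   (ax e) iΓ = InertCtx-∶⁻ iΓ e
  operator-InertM (i-app i _) π      iΓ = Inert⇒InertM i π iΓ

  Inert⇒InertM : ∀ {i Γ M} → Inert i → Γ ⊢ i ⦂ M → InertCtx Γ → InertM M
  Inert⇒InertM i@(i-var _)   (app π _ _ e) iΘ =
    InertM-⊸-target (operator-InertM i π (InertCtx-⊎⁻ˡ iΘ e))
  Inert⇒InertM i@(i-app _ _) (app π _ _ e) iΘ =
    InertM-⊸-target (operator-InertM i π (InertCtx-⊎⁻ˡ iΘ e))

mutual
  operator-size≡ : ∀ {t u Γ M} → Inert (t · u) → (π : Γ ⊢ t ⦂ M) →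
                   InertCtx Γ → size t ≡ ∣ π ∣
  operator-size≡ (i-var _)   (ax _) _  = refl
  operator-size≡ (i-app i _) π      iΓ = Inert-size≡ i π iΓ

  Fireball-𝟎-size≡ : ∀ {f Δ M} → Fireball f → (σ : Δ ⊢ f ⦂ M) → M ≡ 𝟎 →
                     InertCtx Δ → size f ≡ ∣ σ ∣
  Fireball-𝟎-size≡ (f-val v-var) (ax _)          _  _  = refl
  Fireball-𝟎-size≡ (f-val v-lam) (lam []      _) _  _  = refl
  Fireball-𝟎-size≡ (f-val v-lam) (lam (_ ∷ _) _) () _
  Fireball-𝟎-size≡ (f-inert i)   σ               _  iΔ = Inert-size≡ i σ iΔ

  Inert-size≡ : ∀ {i Γ M} → Inert i → (π : Γ ⊢ i ⦂ M) → InertCtx Γ →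
                size i ≡ ∣ π ∣
  Inert-size≡ i@(i-var f)   π iΘ = application-size≡ i f π iΘ
  Inert-size≡ i@(i-app _ f) π iΘ = application-size≡ i f π iΘ

  application-size≡ : ∀ {t u Θ N} → Inert (t · u) → Fireball u →
                      (π : Θ ⊢ t · u ⦂ N) → InertCtx Θ → size (t · u) ≡ ∣ π ∣
  application-size≡ i f (app {Γ = Γ} {M' = M′} π σ M≈M′ e) iΘ =
    cong (_+ 1) (cong₂ _+_ (operator-size≡ i π iΓ)
                           (Fireball-𝟎-size≡ f σ M′≡𝟎 (InertCtx-⊎⁻ʳ iΘ e)))
    where
    iΓ : InertCtx Γ
    iΓ = InertCtx-⊎⁻ˡ iΘ e
    M′≡𝟎 : M′ ≡ 𝟎
    M′≡𝟎 = InertM-⊸-source (operator-InertM i π iΓ) M≈M′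

size≤∣∣ : ∀ {Γ t M} (σ : Γ ⊢ t ⦂ M) → size t ≤ ∣ σ ∣
size≤∣∣ (ax _)        = z≤n
size≤∣∣ (app σ τ _ _) = +-mono-≤ (+-mono-≤ (size≤∣∣ σ) (size≤∣∣ τ)) ≤-refl
size≤∣∣ (lam _ _)     = z≤n

lemma7 : ∀ {i Γ M} → Inert i → (π : Γ ⊢ i ⦂ M) → InertCtx Γ → InertM M →
    (size i ≡ ∣ π ∣) × (∀ {Δ N} (σ : Δ ⊢ i ⦂ N) → ∣ π ∣ ≤ ∣ σ ∣)
lemma7 {i} inert π iΓ _ = i≡π , λ σ → subst (_≤ ∣ σ ∣) i≡π (size≤∣∣ σ)
  where
  i≡π : size i ≡ ∣ π ∣
  i≡π = Inert-size≡ inert π iΓ
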